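{- Let $r\ge 3$ and let $\mathcal{H}=(\mathcal{V},\mathcal{E})$ be an $r$-uniform bi-hypergraph. Suppose $\mathcal{V}$ has a partition $\mathcal{V}_1,\dots,\mathcal{V}_k$ such that each $\mathcal{V}_i$ is independent in $\mathcal{H}$, and such that for each edge $e\in\mathcal{E}$ there are indices $i_1,\dots,i_q\in[k]$ with $q<r$ and $e\subseteq \mathcal{V}_{i_1}\cup\cdots\cup\mathcal{V}_{i_q}$. Then $\mathcal{H}$ is colorable.
   Context: A bi-hypergraph is a pair $\mathcal{H}=(\mathcal{V},\mathcal{E})$ with $\mathcal{V}$ a finite set and $\mathcal{E}$ a Sperner family of subsets of $\mathcal{V}$ (edges); it is $r$-uniform if all edges have size $r$. A set $S\subseteq\mathcal{V}$ is independent if no edge $e$ satisfies $e\subseteq S$. A proper coloring is a map $f:\mathcal{V}\to\mathbb{N}$ with $1<|\{f(v):v\in e\}|<|e|$ for every edge $e$; $\mathcal{H}$ is colorable if such $f$ exists. $[k]=\{1,\dots,k\}$. -}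

module Defs where

open import Data.Nat using (ℕ; _<_)
open import Data.Nat.Properties using (_≟_)
open import Data.Fin using (Fin)
open import Data.Fin.Subset using (Subset; _⊆_; _∈_; ∣_∣; ⋃)
open import Data.Fin.Subset.Properties using (_∈?_)
open import Data.List using (List; map; filter; length; deduplicate; allFin)
open import Data.List.Membership.Propositional renaming (_∈_ to _∈ₗ_)
open import Data.Product using (Σ; _×_)
open import Data.Vec using (tabulate)
open import Data.Bool using (true; false)
open import Relation.Nullary using (does)
import Data.Fin.Properties as FinP
open import Relation.Nullary using (¬_)
open import Relation.Binary.PropositionalEquality using (_≡_)

record BiHypergraph (n : ℕ) : Set where
  field
    edges   : List (Subset n)
    sperner : ∀ {e e′} → e ∈ₗ edges → e′ ∈ₗ edges → e ⊆ e′ → e ≡ e′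

open BiHypergraph public

Uniform : ∀ {n} → ℕ → BiHypergraph n → Set
Uniform r H = ∀ {e} → e ∈ₗ edges H → ∣ e ∣ ≡ r

Independent : ∀ {n} → BiHypergraph n → Subset n → Set
Independent H S = ∀ {e} → e ∈ₗ edges H → ¬ (e ⊆ S)

elems : ∀ {n} → Subset n → List (Fin n)
elems e = filter (_∈? e) (allFin _)

numColors : ∀ {n} → (Fin n → ℕ) → Subset n → ℕ
numColors f e = length (deduplicate _≟_ (map f (elems e)))

ProperColoring : ∀ {n} → BiHypergraph n → (Fin n → ℕ) → Set
ProperColoring H f = ∀ {e} → e ∈ₗ edges H → (1 < numColors f e) × (numColors f e < ∣ e ∣)

Colorable : ∀ {n} → BiHypergraph n → Set
Colorable H = Σ (Fin _ → ℕ) (ProperColoring H)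

-- A partition V_1,...,V_k of the vertex set is given by the class map p : Fin n → Fin k
-- (vertex v lies in V_{p v}).  The class V_i:
part : ∀ {n k} → (Fin n → Fin k) → Fin k → Subset n
part p i = tabulate (λ v → does (p v FinP.≟ i))

partUnion : ∀ {n k} → (Fin n → Fin k) → Subset k → Subset n
partUnion p I = tabulate (λ v → does (p v ∈? I))

-- Colour each vertex by the index of its class.  An edge e lies in the union of
-- fewer than r = |e| classes, so it sees fewer than |e| colours; and e is not
-- contained in a single (independent) class, so it sees at least two.
module Submission where

open import Defs
open import Data.Nat using (ℕ; _<_; _≤_; z≤n; s≤s)
open import Data.Nat.Properties using (_≟_; ≤-trans; ≤-<-trans; n>0⇒n≢0)
open import Data.Fin using (Fin; toℕ)
open import Data.Fin.Subset using (Subset; _⊆_; _∉_; ∣_∣; _-_; Nonempty) renaming (_∈_ to _∈ˢ_)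
open import Data.Fin.Subset.Properties
  using (_∈?_; x∈p∧x≢y⇒x∈p-y; x∈p⇒∣p-x∣<∣p∣; nonempty?; Empty-unique; ∣⊥∣≡0)
open import Data.Fin.Properties using (toℕ-injective; ¬∀⟶∃¬) renaming (_≟_ to _≟ᶠ_)
open import Data.List using (List; []; _∷_; length; map; deduplicate; allFin)
open import Data.List.Membership.Propositional using (_∈_)
open import Data.List.Membership.Propositional.Properties
  using (∈-deduplicate⁻; ∈-deduplicate⁺; ∈-map⁺; ∈-map⁻; ∈-filter⁺; ∈-filter⁻; ∈-allFin)
open import Data.List.Relation.Unary.Any using (here; there)
open import Data.List.Relation.Unary.All using (lookup)
open import Data.List.Relation.Unary.AllPairs using (_∷_)
open import Data.List.Relation.Unary.Unique.Propositional using (Unique)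
open import Data.List.Relation.Unary.Unique.DecPropositional.Properties using (deduplicate-!)
open import Data.Product using (Σ; ∃; _×_; _,_; proj₂)
open import Data.Vec using (tabulate)
open import Data.Vec.Properties using ([]=⇒lookup; lookup⇒[]=; lookup∘tabulate)
open import Data.Bool using (Bool; true)
open import Function using (_∘_)
open import Relation.Nullary using (¬_; yes; no; does; contradiction)
open import Relation.Nullary.Decidable using (_→-dec_)
open import Relation.Binary.PropositionalEquality using (_≡_; _≢_; refl; sym; trans; cong; subst)

∈-tabulate⁻ : ∀ {n} (g : Fin n → Bool) {v} → v ∈ˢ tabulate g → g v ≡ true
∈-tabulate⁻ g {v} v∈ = trans (sym (lookup∘tabulate g v)) ([]=⇒lookup v∈)

∈-tabulate⁺ : ∀ {n} (g : Fin n → Bool) {v} → g v ≡ true → v ∈ˢ tabulate g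
∈-tabulate⁺ g {v} gv = lookup⇒[]= v (tabulate g) (trans (lookup∘tabulate g v) gv)

∈-partUnion⁻ : ∀ {n k} (p : Fin n → Fin k) I {v} → v ∈ˢ partUnion p I → p v ∈ˢ I
∈-partUnion⁻ p I {v} v∈ with p v ∈? I | ∈-tabulate⁻ (λ w → does (p w ∈? I)) v∈
... | yes pv∈I | _ = pv∈I
... | no _     | ()

∈-part⁺ : ∀ {n k} (p : Fin n → Fin k) {v i} → p v ≡ i → v ∈ˢ part p i
∈-part⁺ p {v} {i} pv≡i = ∈-tabulate⁺ (λ w → does (p w ≟ᶠ i)) does-pv≟i
  where
  does-pv≟i : does (p v ≟ᶠ i) ≡ true
  does-pv≟i with p v ≟ᶠ i
  ... | yes _    = refl
  ... | no pv≢i = contradiction pv≡i pv≢i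

∈-elems⁺ : ∀ {n} {e : Subset n} {v} → v ∈ˢ e → v ∈ elems e
∈-elems⁺ {v = v} v∈e = ∈-filter⁺ (_∈? _) (∈-allFin v) v∈e

∈-elems⁻ : ∀ {n} {e : Subset n} {v} → v ∈ elems e → v ∈ˢ e
∈-elems⁻ {n} {e} v∈ = proj₂ (∈-filter⁻ (_∈? e) {xs = allFin n} v∈)

0<∣p∣⇒Nonempty : ∀ {n} {p : Subset n} → 0 < ∣ p ∣ → Nonempty p
0<∣p∣⇒Nonempty {n} {p} 0<∣p∣ with nonempty? p
... | yes p≢∅ = p≢∅
... | no p≡∅  = contradiction (trans (cong ∣_∣ (Empty-unique p≡∅)) (∣⊥∣≡0 n)) (n>0⇒n≢0 0<∣p∣)

⊈⇒∃∉ : ∀ {n} {p q : Subset n} → ¬ (p ⊆ q) → ∃ λ v → v ∈ˢ p × v ∉ q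
⊈⇒∃∉ {n} {p} {q} p⊈q with ¬∀⟶∃¬ n (λ v → v ∈ˢ p → v ∈ˢ q) (λ v → (v ∈? p) →-dec (v ∈? q)) (λ p⊆q → p⊈q (p⊆q _))
... | v , v∉ with v ∈? p
...   | yes v∈p = v , v∈p , λ v∈q → v∉ (λ _ → v∈q)
...   | no  v∉p = contradiction (λ v∈p → contradiction v∈p v∉p) v∉

1<length : ∀ {A : Set} {xs : List A} {x y} → x ∈ xs → y ∈ xs → x ≢ y → 1 < length xs
1<length (here refl) (here refl)              x≢y = contradiction refl x≢y
1<length (here refl) (there {xs = _ ∷ _} _)   _   = s≤s (s≤s z≤n)
1<length (there {xs = _ ∷ _} _) _             _   = s≤s (s≤s z≤n)

length≤∣∣ : ∀ {k} {A : Set} (g : Fin k → A) (I : Subset k) {xs : List A} → Unique xs →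
            (∀ {y} → y ∈ xs → ∃ λ j → j ∈ˢ I × g j ≡ y) → length xs ≤ ∣ I ∣
length≤∣∣ g I {[]}     _            _    = z≤n
length≤∣∣ g I {x ∷ xs} (x∉xs ∷ !xs) ⊆gI with ⊆gI (here refl)
... | j , j∈I , refl = ≤-<-trans (length≤∣∣ g (I - j) !xs ⊆g[I-j]) (x∈p⇒∣p-x∣<∣p∣ j∈I)
  where
  ⊆g[I-j] : ∀ {y} → y ∈ xs → ∃ λ j′ → j′ ∈ˢ I - j × g j′ ≡ y
  ⊆g[I-j] y∈xs with ⊆gI (there y∈xs)
  ... | j′ , j′∈I , gj′≡y =
    j′ , x∈p∧x≢y⇒x∈p-y j′∈I (λ j′≡j → lookup x∉xs y∈xs (trans (cong g (sym j′≡j)) gj′≡y)) , gj′≡y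

1<numColors : ∀ {n} (f : Fin n → ℕ) {e : Subset n} {v w} →
              v ∈ˢ e → w ∈ˢ e → f v ≢ f w → 1 < numColors f e
1<numColors f {e} v∈e w∈e = 1<length (colour∈ v∈e) (colour∈ w∈e)
  where
  colour∈ : ∀ {u} → u ∈ˢ e → f u ∈ deduplicate _≟_ (map f (elems e))
  colour∈ u∈e = ∈-deduplicate⁺ _≟_ (∈-map⁺ f (∈-elems⁺ u∈e))

numColors-∘-≤ : ∀ {n k} (g : Fin k → ℕ) (p : Fin n → Fin k) {e : Subset n} {I : Subset k} →
                e ⊆ partUnion p I → numColors (g ∘ p) e ≤ ∣ I ∣
numColors-∘-≤ g p {e} {I} e⊆⋃I = length≤∣∣ g I (deduplicate-! _≟_ colours) colour∈gI
  where
  colours : List ℕ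
  colours = map (g ∘ p) (elems e)

  colour∈gI : ∀ {y} → y ∈ deduplicate _≟_ colours → ∃ λ j → j ∈ˢ I × g j ≡ y
  colour∈gI y∈ with ∈-map⁻ (g ∘ p) (∈-deduplicate⁻ _≟_ colours y∈)
  ... | v , v∈e , refl = p v , ∈-partUnion⁻ p I (e⊆⋃I (∈-elems⁻ v∈e)) , refl

lemma2p2 : (r : ℕ) → 3 ≤ r → (n : ℕ) → (H : BiHypergraph n) → Uniform r H →
           (k : ℕ) → (p : Fin n → Fin k) →
           (∀ i → Independent H (part p i)) →
           (∀ {e} → e ∈ edges H → Σ (Subset k) (λ I → (∣ I ∣ < r) × (e ⊆ partUnion p I))) →
           Colorable H
lemma2p2 r 3≤r n H uniform k p independent covered = toℕ ∘ p , proper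
  where
  proper : ProperColoring H (toℕ ∘ p)
  proper {e} e∈H = atLeastTwo , fewerThan∣e∣
    where
    ∣e∣≡r : ∣ e ∣ ≡ r
    ∣e∣≡r = uniform e∈H

    atLeastTwo : 1 < numColors (toℕ ∘ p) e
    atLeastTwo with 0<∣p∣⇒Nonempty (subst (0 <_) (sym ∣e∣≡r) (≤-trans (s≤s z≤n) 3≤r))
    ... | v , v∈e with ⊈⇒∃∉ (independent (p v) e∈H)
    ...   | w , w∈e , w∉V[pv] =
      1<numColors (toℕ ∘ p) v∈e w∈e (λ pv≡pw → w∉V[pv] (∈-part⁺ p (sym (toℕ-injective pv≡pw))))

    fewerThan∣e∣ : numColors (toℕ ∘ p) e < ∣ e ∣
    fewerThan∣e∣ with covered e∈H
    ... | I , ∣I∣<r , e⊆⋃I =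
      subst (numColors (toℕ ∘ p) e <_) (sym ∣e∣≡r) (≤-<-trans (numColors-∘-≤ toℕ p e⊆⋃I) ∣I∣<r)
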